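{- Let $a,b,c$ be commuting indeterminates and let $D$ be the derivation of $\mathbb{Q}[a,b,c]$ determined by $D(a)=a^2b$, $D(b)=b^2c$, $D(c)=bc^2$. For $0\le k\le n$ let $H(n,k)=\frac{(2n-k)!}{2^{n-k}(n-k)!}$. Then for all $n\ge0$, $$D^n(ab)=ab^{n+1}\sum_{k=0}^nH(n,k)a^kc^{n-k}.$$
   Context: $D$ is the formal derivative of the context-free grammar $\{a\rightarrow a^2b, b\rightarrow b^2c, c\rightarrow bc^2\}$, i.e. a linear map satisfying the Leibniz rule $D(uv)=D(u)v+uD(v)$; $D^0$ is the identity. -}

module Defs where

open import Data.Nat as ℕ using (ℕ; zero; suc; _∸_; _^_; _!)
open import Data.Nat.Properties using (m^n≢0; _!≢0; m*n≢0)
open import Data.Integer using (+_)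
open import Data.Rational using (ℚ; _/_; 0ℚ; 1ℚ; _+_; _*_)
open import Data.List using (List; []; _∷_; _++_; concatMap; map; foldr)
open import Data.Product using (_×_; _,_)
open import Relation.Binary.PropositionalEquality using (_≡_)
open import Relation.Nullary.Decidable using (⌊_⌋)
open import Data.Bool using (Bool; if_then_else_; _∧_)

-- A term  q · a^i b^j c^k  of Q[a,b,c].
record Term : Set where
  constructor term
  field
    coef : ℚ
    ea eb ec : ℕ

-- A polynomial in Q[a,b,c], represented as a finite formal sum of terms.
-- Two representations denote the same polynomial iff all coefficients agree
-- (see _≈_ below).
Poly : Set
Poly = List Term

mono : ℚ → ℕ → ℕ → ℕ → Poly
mono q i j k = term q i j k ∷ []

_⊕_ : Poly → Poly → Poly
p ⊕ q = p ++ q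

mulTerm : Term → Term → Term
mulTerm (term q i j k) (term q' i' j' k') = term (q * q') (i ℕ.+ i') (j ℕ.+ j') (k ℕ.+ k')

_⊗_ : Poly → Poly → Poly
p ⊗ q = concatMap (λ s → map (mulTerm s) q) p

coeff : Poly → ℕ → ℕ → ℕ → ℚ
coeff [] i j k = 0ℚ
coeff (term q i' j' k' ∷ p) i j k =
  (if ⌊ i ℕ.≟ i' ⌋ ∧ ⌊ j ℕ.≟ j' ⌋ ∧ ⌊ k ℕ.≟ k' ⌋ then q else 0ℚ) + coeff p i j k

_≈_ : Poly → Poly → Set
p ≈ q = ∀ i j k → coeff p i j k ≡ coeff q i j k

infix 4 _≈_
infixl 6 _⊕_
infixl 7 _⊗_

ℕ→ℚ : ℕ → ℚ
ℕ→ℚ n = (+ n) / 1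

-- The derivation D of Q[a,b,c] with D(a) = a²b, D(b) = b²c, D(c) = bc².
-- It is Q-linear (defined termwise) and, by the Leibniz rule, on a monomial
--   D(a^i b^j c^k) = i a^{i-1}b^j c^k · a²b + j a^i b^{j-1} c^k · b²c + k a^i b^j c^{k-1} · bc²
--                  = i a^{i+1}b^{j+1}c^k + j a^i b^{j+1}c^{k+1} + k a^i b^{j+1}c^{k+1}.
DTerm : Term → Poly
DTerm (term q i j k) =
  term (q * ℕ→ℚ i) (suc i) (suc j) k ∷
  term (q * ℕ→ℚ j) i (suc j) (suc k) ∷
  term (q * ℕ→ℚ k) i (suc j) (suc k) ∷ []

D : Poly → Poly
D = concatMap DTerm

D^ : ℕ → Poly → Poly
D^ zero p = p
D^ (suc n) p = D (D^ n p)

H : ℕ → ℕ → ℚ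
H n k = ((+ ((2 ℕ.* n ∸ k) !)) / (2 ^ (n ∸ k) ℕ.* (n ∸ k) !))
          {{m*n≢0 (2 ^ (n ∸ k)) ((n ∸ k) !) {{m^n≢0 2 (n ∸ k)}} {{(n ∸ k) !≢0}}}}

Σ≤ : ℕ → (ℕ → Poly) → Poly
Σ≤ zero f = f 0
Σ≤ (suc n) f = Σ≤ n f ⊕ f (suc n)

a b c : Poly
a = mono 1ℚ 1 0 0
b = mono 1ℚ 0 1 0
c = mono 1ℚ 0 0 1

_↑_ : Poly → ℕ → Poly
p ↑ zero = mono 1ℚ 0 0 0
p ↑ suc n = p ⊗ (p ↑ n)

_·_ : ℚ → Poly → Poly
q · p = mono q 0 0 0 ⊗ p

module Submission where

-- Write n = m + k.  The claim says that D^n(ab) is supported on the monomials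
-- a^(m+1) b^(n+1) c^k, with coefficient G(m,k) = (m+2k)! / (2^k k!) = H(m+k, m).
-- Since D(a^i b^j c^k) = i a^(i+1) b^(j+1) c^k + (j+k) a^i b^(j+1) c^(k+1), one
-- application of D turns these coefficients into
--   m G(m-1,k) + (m+2k-1) G(m,k-1) = G(m,k)   (on level n+1),
-- which is the recurrence defining G.

open import Defs
open import Data.Nat using (ℕ; zero; suc; _+_; _*_; _∸_; _^_; _!; _≤?_; _≟_; z≤n; NonZero)
open import Data.Nat.Properties as ℕ using (m^n≢0; _!≢0; m*n≢0)
open import Data.Nat.Tactic.RingSolver using (solve-∀)
open import Data.Nat.Coprimality using (1-coprimeTo) renaming (sym to coprime-sym)
open import Data.Integer as ℤ using (+_)
import Data.Integer.Properties as ℤ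
open import Data.Rational using (ℚ; 0ℚ; 1ℚ; mkℚ; _/_) renaming (_+_ to _+ℚ_; _*_ to _*ℚ_)
open import Data.Rational.Properties
  using (+-identityˡ; +-identityʳ; +-assoc; *-zeroˡ; *-identityˡ; *-identityʳ; *-distribˡ-+; *-distribʳ-+;
         +-0-commutativeMonoid; normalize-coprime; /-cong; fromℚᵘ-cong)
open import Data.Rational.Unnormalised using (mkℚᵘ; *≡*)
open import Algebra.Bundles using (CommutativeMonoid)
open import Algebra.Properties.CommutativeSemigroup
  (CommutativeMonoid.commutativeSemigroup +-0-commutativeMonoid) using (interchange)
open import Data.List using ([]; _∷_; _++_; map)
open import Data.List.Properties using (map-++; ++-identityʳ)
open import Data.Bool using (if_then_else_; _∧_)
open import Data.Product using (_×_; _,_)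
open import Data.Empty using (⊥-elim)
open import Relation.Nullary using (Dec; yes; no; ¬_)
open import Relation.Nullary.Decidable using (⌊_⌋; _×-dec_)
open import Relation.Binary.Definitions using (tri<; tri≈; tri>)
open import Function.Bundles using (_⇔_; mk⇔; Equivalence)
open import Relation.Binary.PropositionalEquality
open ≡-Reasoning

-- 1. Natural numbers inside ℚ

ℕ→ℚ-mkℚ : ∀ n → ℕ→ℚ n ≡ mkℚ (+ n) 0 (coprime-sym (1-coprimeTo n))
ℕ→ℚ-mkℚ n = normalize-coprime (coprime-sym (1-coprimeTo n))

ℕ→ℚ-+ : ∀ m n → ℕ→ℚ (m + n) ≡ ℕ→ℚ m +ℚ ℕ→ℚ n
ℕ→ℚ-+ m n =
  trans (/-cong {+ (m + n)} {1} (cong₂ ℤ._+_ (sym (ℤ.*-identityʳ (+ m))) (sym (ℤ.*-identityʳ (+ n)))) refl)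
        (sym (cong₂ _+ℚ_ (ℕ→ℚ-mkℚ m) (ℕ→ℚ-mkℚ n)))

ℕ→ℚ-* : ∀ m n → ℕ→ℚ (m * n) ≡ ℕ→ℚ m *ℚ ℕ→ℚ n
ℕ→ℚ-* m n = trans (/-cong {+ (m * n)} {1} (ℤ.pos-* m n) refl) (sym (cong₂ _*ℚ_ (ℕ→ℚ-mkℚ m) (ℕ→ℚ-mkℚ n)))

/-cancel : ∀ g d .{{_ : NonZero d}} → (+ (g * d)) / d ≡ ℕ→ℚ g
/-cancel g (suc d) = fromℚᵘ-cong {mkℚᵘ (+ (g * suc d)) d} {mkℚᵘ (+ g) 0}
                       (*≡* (trans (ℤ.*-identityʳ _) (ℤ.pos-* g (suc d))))

-- 2. Restricted values

-- ⟦ p ⟧ x is x when the decided proposition holds and 0 otherwise.  It is opaque,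
-- so that the lemmas below can read the decision procedure off the goal.
opaque
  ⟦_⟧_ : {P : Set} → Dec P → ℚ → ℚ
  ⟦ p ⟧ x = if ⌊ p ⌋ then x else 0ℚ

infix 8 ⟦_⟧_

opaque
  unfolding ⟦_⟧_

  ⟦⟧-cong : ∀ {P Q : Set} {p : Dec P} {q : Dec Q} {x y : ℚ} → P ⇔ Q → (P → x ≡ y) → ⟦ p ⟧ x ≡ ⟦ q ⟧ y
  ⟦⟧-cong {p = yes hp} {yes _}  P⇔Q x≡y = x≡y hp
  ⟦⟧-cong {p = yes hp} {no ¬hq} P⇔Q x≡y = ⊥-elim (¬hq (Equivalence.to P⇔Q hp))
  ⟦⟧-cong {p = no ¬hp} {yes hq} P⇔Q x≡y = ⊥-elim (¬hp (Equivalence.from P⇔Q hq))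
  ⟦⟧-cong {p = no _}   {no _}   P⇔Q x≡y = refl

  ⟦⟧-off : ∀ {P : Set} {p : Dec P} {x : ℚ} → ¬ P → ⟦ p ⟧ x ≡ 0ℚ
  ⟦⟧-off {p = yes hp} ¬hp = ⊥-elim (¬hp hp)
  ⟦⟧-off {p = no _}   ¬hp = refl

  ⟦⟧-*ʳ : ∀ {P : Set} {p : Dec P} {x y : ℚ} → ⟦ p ⟧ x *ℚ y ≡ ⟦ p ⟧ (x *ℚ y)
  ⟦⟧-*ʳ {p = yes _}        = refl
  ⟦⟧-*ʳ {p = no _} {y = y} = *-zeroˡ y

  ⟦⟧-+ : ∀ {P : Set} {p : Dec P} {x y : ℚ} → ⟦ p ⟧ x +ℚ ⟦ p ⟧ y ≡ ⟦ p ⟧ (x +ℚ y)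
  ⟦⟧-+ {p = yes _} = refl
  ⟦⟧-+ {p = no _}  = +-identityˡ 0ℚ

  ⟦⟧-+-cong : ∀ {P Q R : Set} {p : Dec P} {q : Dec Q} {r : Dec R} {x y z : ℚ} →
              P ⇔ R → Q ⇔ R → (R → x +ℚ y ≡ z) → ⟦ p ⟧ x +ℚ ⟦ q ⟧ y ≡ ⟦ r ⟧ z
  ⟦⟧-+-cong {p = yes _}  {yes _}  {yes hr} P⇔R Q⇔R sum = sum hr
  ⟦⟧-+-cong {p = no _}   {no _}   {no _}   P⇔R Q⇔R sum = +-identityˡ 0ℚ
  ⟦⟧-+-cong {p = yes hp} {_}      {no ¬hr} P⇔R Q⇔R sum = ⊥-elim (¬hr (Equivalence.to P⇔R hp))
  ⟦⟧-+-cong {p = no _}   {yes hq} {no ¬hr} P⇔R Q⇔R sum = ⊥-elim (¬hr (Equivalence.to Q⇔R hq))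
  ⟦⟧-+-cong {p = no ¬hp} {_}      {yes hr} P⇔R Q⇔R sum = ⊥-elim (¬hp (Equivalence.from P⇔R hr))
  ⟦⟧-+-cong {p = yes _}  {no ¬hq} {yes hr} P⇔R Q⇔R sum = ⊥-elim (¬hq (Equivalence.from Q⇔R hr))

-- Splitting the condition i ≤ n+1 into i ≤ n and i = n+1 (stated with a-degrees i+1, n+2):
-- the two restrictions add up to the restriction to i ≤ n+1.
⟦⟧-extend : ∀ {A : ℕ → Set} (r : ∀ m → Dec (A m)) (h : ℕ → ℚ) n i →
  ⟦ i ≤? n ×-dec r i ⟧ h i +ℚ ⟦ suc i ≟ suc (suc n) ×-dec r (suc n) ⟧ h (suc n) ≡ ⟦ i ≤? suc n ×-dec r i ⟧ h i
⟦⟧-extend r h n i with ℕ.<-cmp i (suc n)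
... | tri< i<1+n _ _ =
  trans (cong (⟦ i ≤? n ×-dec r i ⟧ h i +ℚ_) (⟦⟧-off λ { (e , _) → ℕ.<-irrefl (ℕ.suc-injective e) i<1+n }))
        (trans (+-identityʳ _)
               (⟦⟧-cong (mk⇔ (λ { (i≤n , x) → ℕ.m≤n⇒m≤1+n i≤n , x }) (λ { (_ , x) → ℕ.m<1+n⇒m≤n i<1+n , x }))
                        (λ _ → refl)))
... | tri≈ _ refl _ =
  trans (cong (_+ℚ ⟦ suc (suc n) ≟ suc (suc n) ×-dec r (suc n) ⟧ h (suc n)) (⟦⟧-off λ { (1+n≤n , _) → ℕ.<-irrefl refl 1+n≤n }))
        (trans (+-identityˡ _) (⟦⟧-cong (mk⇔ (λ { (_ , x) → ℕ.≤-refl , x }) (λ { (_ , x) → refl , x })) (λ _ → refl)))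
... | tri> _ _ 1+n<i =
  trans (cong₂ _+ℚ_ (⟦⟧-off λ { (i≤n , _) → ℕ.<⇒≱ 1+n<i (ℕ.m≤n⇒m≤1+n i≤n) })
                    (⟦⟧-off λ { (e , _) → ℕ.<-irrefl (sym (ℕ.suc-injective e)) 1+n<i }))
        (sym (⟦⟧-off λ { (i≤1+n , _) → ℕ.<⇒≱ 1+n<i i≤1+n }))

-- 3. Coefficients of the representation

Coeffs : Set
Coeffs = ℕ → ℕ → ℕ → ℚ

termCoeffs : Term → Coeffs
termCoeffs (term q i' j' k') i j k = ⟦ i ≟ i' ×-dec j ≟ j' ×-dec k ≟ k' ⟧ q

opaque
  unfolding ⟦_⟧_

  coeff-∷ : ∀ t p i j k → coeff (t ∷ p) i j k ≡ termCoeffs t i j k +ℚ coeff p i j k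
  coeff-∷ (term q i' j' k') p i j k = cong (_+ℚ coeff p i j k) (if-∧ (i ≟ i') (j ≟ j') (k ≟ k'))
    where
    if-∧ : {A B C : Set} (u : Dec A) (v : Dec B) (w : Dec C) →
           (if ⌊ u ⌋ ∧ ⌊ v ⌋ ∧ ⌊ w ⌋ then q else 0ℚ) ≡ (if ⌊ u ×-dec v ×-dec w ⌋ then q else 0ℚ)
    if-∧ (yes _) (yes _) (yes _) = refl
    if-∧ (yes _) (yes _) (no _)  = refl
    if-∧ (yes _) (no _)  _       = refl
    if-∧ (no _)  _       _       = refl

coeff-mono : ∀ q i' j' k' i j k → coeff (mono q i' j' k') i j k ≡ ⟦ i ≟ i' ×-dec j ≟ j' ×-dec k ≟ k' ⟧ q
coeff-mono q i' j' k' i j k = trans (coeff-∷ (term q i' j' k') [] i j k) (+-identityʳ _)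

coeff-++ : ∀ p q i j k → coeff (p ++ q) i j k ≡ coeff p i j k +ℚ coeff q i j k
coeff-++ []      q i j k = sym (+-identityˡ _)
coeff-++ (t ∷ p) q i j k = begin
  coeff (t ∷ p ++ q) i j k                                   ≡⟨ coeff-∷ t (p ++ q) i j k ⟩
  termCoeffs t i j k +ℚ coeff (p ++ q) i j k                 ≡⟨ cong (termCoeffs t i j k +ℚ_) (coeff-++ p q i j k) ⟩
  termCoeffs t i j k +ℚ (coeff p i j k +ℚ coeff q i j k)     ≡⟨ sym (+-assoc (termCoeffs t i j k) (coeff p i j k) (coeff q i j k)) ⟩
  (termCoeffs t i j k +ℚ coeff p i j k) +ℚ coeff q i j k     ≡⟨ cong (_+ℚ coeff q i j k) (sym (coeff-∷ t p i j k)) ⟩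
  coeff (t ∷ p) i j k +ℚ coeff q i j k                       ∎

-- The effect of D on coefficients.  D(a) = a²b moves a^i b^j c^k to i a^(i+1) b^(j+1) c^k;
-- D(b) = b²c and D(c) = bc² together move it to (j+k) a^i b^(j+1) c^(k+1).
fromA : Coeffs → Coeffs
fromA f (suc i) (suc j) k = f i j k *ℚ ℕ→ℚ i
fromA f _       _       _ = 0ℚ

fromBC : Coeffs → Coeffs
fromBC f i (suc j) (suc k) = f i j k *ℚ ℕ→ℚ (j + k)
fromBC f _ _       _       = 0ℚ

Dᶜ : Coeffs → Coeffs
Dᶜ f i j k = fromA f i j k +ℚ fromBC f i j k

Dᶜ-cong : ∀ {f g : Coeffs} → (∀ i j k → f i j k ≡ g i j k) → ∀ i j k → Dᶜ f i j k ≡ Dᶜ g i j k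
Dᶜ-cong {f} {g} f≗g i j k = cong₂ _+ℚ_ (a-part i j k) (bc-part i j k)
  where
  a-part : ∀ i j k → fromA f i j k ≡ fromA g i j k
  a-part (suc i) (suc j) k = cong (_*ℚ ℕ→ℚ i) (f≗g i j k)
  a-part zero    _       k = refl
  a-part (suc i) zero    k = refl
  bc-part : ∀ i j k → fromBC f i j k ≡ fromBC g i j k
  bc-part i (suc j) (suc k) = cong (_*ℚ ℕ→ℚ (j + k)) (f≗g i j k)
  bc-part i zero    k       = refl
  bc-part i (suc j) zero    = refl

Dᶜ-+ : ∀ f g i j k → Dᶜ (λ i j k → f i j k +ℚ g i j k) i j k ≡ Dᶜ f i j k +ℚ Dᶜ g i j k
Dᶜ-+ f g i j k = trans (cong₂ _+ℚ_ (a-part i j k) (bc-part i j k))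
                       (interchange (fromA f i j k) (fromA g i j k) (fromBC f i j k) (fromBC g i j k))
  where
  a-part : ∀ i j k → fromA (λ i j k → f i j k +ℚ g i j k) i j k ≡ fromA f i j k +ℚ fromA g i j k
  a-part (suc i) (suc j) k = *-distribʳ-+ (ℕ→ℚ i) (f i j k) (g i j k)
  a-part zero    _       k = refl
  a-part (suc i) zero    k = refl
  bc-part : ∀ i j k → fromBC (λ i j k → f i j k +ℚ g i j k) i j k ≡ fromBC f i j k +ℚ fromBC g i j k
  bc-part i (suc j) (suc k) = *-distribʳ-+ (ℕ→ℚ (j + k)) (f i j k) (g i j k)
  bc-part i zero    k       = refl
  bc-part i (suc j) zero    = refl

Dᶜ-0 : ∀ i j k → Dᶜ (λ _ _ _ → 0ℚ) i j k ≡ 0ℚ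
Dᶜ-0 (suc i) (suc j) (suc k) = cong₂ _+ℚ_ (*-zeroˡ (ℕ→ℚ i)) (*-zeroˡ (ℕ→ℚ (j + k)))
Dᶜ-0 (suc i) (suc j) zero    = cong (_+ℚ 0ℚ) (*-zeroˡ (ℕ→ℚ i))
Dᶜ-0 zero    (suc j) (suc k) = cong (0ℚ +ℚ_) (*-zeroˡ (ℕ→ℚ (j + k)))
Dᶜ-0 zero    (suc j) zero    = refl
Dᶜ-0 (suc i) zero    k       = refl
Dᶜ-0 zero    zero    k       = refl

coeff-DTerm : ∀ t i j k → coeff (DTerm t) i j k ≡ Dᶜ (termCoeffs t) i j k
coeff-DTerm t@(term q i' j' k') i j k = begin
  coeff (DTerm t) i j k
    ≡⟨ coeff-∷ tA (tB ∷ tC ∷ []) i j k ⟩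
  termCoeffs tA i j k +ℚ coeff (tB ∷ tC ∷ []) i j k
    ≡⟨ cong (termCoeffs tA i j k +ℚ_) (trans (coeff-∷ tB (tC ∷ []) i j k) (cong (termCoeffs tB i j k +ℚ_) (coeff-∷ tC [] i j k))) ⟩
  termCoeffs tA i j k +ℚ (termCoeffs tB i j k +ℚ (termCoeffs tC i j k +ℚ 0ℚ))
    ≡⟨ cong₂ _+ℚ_ (raiseA i j k) (trans (cong (termCoeffs tB i j k +ℚ_) (+-identityʳ _)) ⟦⟧-+) ⟩
  fromA (termCoeffs t) i j k +ℚ ⟦ i ≟ i' ×-dec j ≟ suc j' ×-dec k ≟ suc k' ⟧ (q *ℚ ℕ→ℚ j' +ℚ q *ℚ ℕ→ℚ k')
    ≡⟨ cong (fromA (termCoeffs t) i j k +ℚ_) (raiseBC i j k) ⟩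
  Dᶜ (termCoeffs t) i j k ∎
  where
  tA tB tC : Term
  tA = term (q *ℚ ℕ→ℚ i') (suc i') (suc j') k'
  tB = term (q *ℚ ℕ→ℚ j') i' (suc j') (suc k')
  tC = term (q *ℚ ℕ→ℚ k') i' (suc j') (suc k')

  raiseA : ∀ i j k → termCoeffs tA i j k ≡ fromA (termCoeffs t) i j k
  raiseA zero    j       k = ⟦⟧-off λ ()
  raiseA (suc i) zero    k = ⟦⟧-off λ ()
  raiseA (suc i) (suc j) k = sym (trans ⟦⟧-*ʳ
    (⟦⟧-cong (mk⇔ (λ { (refl , refl , refl) → refl , refl , refl }) (λ { (refl , refl , refl) → refl , refl , refl }))
             (λ { (refl , _) → refl })))

  raiseBC : ∀ i j k → ⟦ i ≟ i' ×-dec j ≟ suc j' ×-dec k ≟ suc k' ⟧ (q *ℚ ℕ→ℚ j' +ℚ q *ℚ ℕ→ℚ k')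
                    ≡ fromBC (termCoeffs t) i j k
  raiseBC i zero    k       = ⟦⟧-off λ ()
  raiseBC i (suc j) zero    = ⟦⟧-off λ ()
  raiseBC i (suc j) (suc k) = sym (trans ⟦⟧-*ʳ
    (⟦⟧-cong (mk⇔ (λ { (refl , refl , refl) → refl , refl , refl }) (λ { (refl , refl , refl) → refl , refl , refl }))
             (λ { (refl , refl , refl) → trans (cong (q *ℚ_) (ℕ→ℚ-+ j' k')) (*-distribˡ-+ q (ℕ→ℚ j') (ℕ→ℚ k')) })))

coeff-D : ∀ p i j k → coeff (D p) i j k ≡ Dᶜ (coeff p) i j k
coeff-D []      i j k = sym (Dᶜ-0 i j k)
coeff-D (t ∷ p) i j k = begin
  coeff (DTerm t ++ D p) i j k                               ≡⟨ coeff-++ (DTerm t) (D p) i j k ⟩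
  coeff (DTerm t) i j k +ℚ coeff (D p) i j k                 ≡⟨ cong₂ _+ℚ_ (coeff-DTerm t i j k) (coeff-D p i j k) ⟩
  Dᶜ (termCoeffs t) i j k +ℚ Dᶜ (coeff p) i j k             ≡⟨ Dᶜ-+ (termCoeffs t) (coeff p) i j k ⟨
  Dᶜ (λ i j k → termCoeffs t i j k +ℚ coeff p i j k) i j k  ≡⟨ Dᶜ-cong (coeff-∷ t p) i j k ⟨
  Dᶜ (coeff (t ∷ p)) i j k                                   ∎

-- 4. The numbers G(m,k)

-- G(m,k) will be the coefficient of a^(m+1) b^(m+k+1) c^k in D^(m+k)(ab).  It is defined
-- by the recurrence G(m,k) = m G(m-1,k) + (m+2k-1) G(m,k-1) that D imposes (terms
-- with a negative index omitted), starting from G(0,0) = 1.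
G : ℕ → ℕ → ℕ
G zero    zero    = 1
G zero    (suc k) = (1 + 2 * k) * G zero k
G (suc m) zero    = suc m * G m zero
G (suc m) (suc k) = suc m * G m (suc k) + (2 + m + 2 * k) * G (suc m) k

G-closed : ∀ m k → G m k * (2 ^ k * k !) ≡ (m + 2 * k) !
G-closed zero    zero    = refl
G-closed zero    (suc k) = begin
  (1 + 2 * k) * G 0 k * (2 * 2 ^ k * (suc k * k !))      ≡⟨ regroup k (G 0 k) (2 ^ k) (k !) ⟩
  (2 + 2 * k) * ((1 + 2 * k) * (G 0 k * (2 ^ k * k !)))  ≡⟨ cong (λ x → (2 + 2 * k) * ((1 + 2 * k) * x)) (G-closed 0 k) ⟩
  (2 + 2 * k) !                                           ≡⟨ cong _! (double-suc k) ⟩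
  (2 * suc k) !                                           ∎
  where
  regroup : ∀ k g p f → (1 + 2 * k) * g * (2 * p * ((1 + k) * f)) ≡ (2 + 2 * k) * ((1 + 2 * k) * (g * (p * f)))
  regroup = solve-∀
  double-suc : ∀ k → 2 + 2 * k ≡ 2 * (1 + k)
  double-suc = solve-∀
G-closed (suc m) zero    = begin
  suc m * G m 0 * 1         ≡⟨ ℕ.*-assoc (suc m) (G m 0) 1 ⟩
  suc m * (G m 0 * 1)       ≡⟨ cong (suc m *_) (G-closed m 0) ⟩
  suc m * (m + 0) !         ≡⟨ cong (λ x → suc x * (m + 0) !) (ℕ.+-identityʳ m) ⟨
  (suc m + 0) !             ∎
G-closed (suc m) (suc k) = begin
  (suc m * G m (suc k) + (2 + m + 2 * k) * G (suc m) k) * (2 * 2 ^ k * (suc k * k !))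
    ≡⟨ regroup m k (G m (suc k)) (G (suc m) k) (2 ^ k) (k !) ⟩
  suc m * (G m (suc k) * (2 * 2 ^ k * (suc k * k !))) + (2 + m + 2 * k) * (2 + 2 * k) * (G (suc m) k * (2 ^ k * k !))
    ≡⟨ cong₂ (λ x y → suc m * x + (2 + m + 2 * k) * (2 + 2 * k) * y) (G-closed m (suc k)) (G-closed (suc m) k) ⟩
  suc m * (m + 2 * suc k) ! + (2 + m + 2 * k) * (2 + 2 * k) * (suc m + 2 * k) !
    ≡⟨ cong (λ x → suc m * x ! + (2 + m + 2 * k) * (2 + 2 * k) * (suc m + 2 * k) !) (shift m k) ⟩
  suc m * (2 + m + 2 * k) ! + (2 + m + 2 * k) * (2 + 2 * k) * (suc m + 2 * k) !
    ≡⟨ collect m k ((1 + m + 2 * k) !) ⟩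
  (3 + m + 2 * k) !
    ≡⟨ cong _! (shift (suc m) k) ⟨
  (suc m + 2 * suc k) !
    ∎
  where
  regroup : ∀ m k g₁ g₂ p f → ((1 + m) * g₁ + (2 + m + 2 * k) * g₂) * (2 * p * ((1 + k) * f))
          ≡ (1 + m) * (g₁ * (2 * p * ((1 + k) * f))) + (2 + m + 2 * k) * (2 + 2 * k) * (g₂ * (p * f))
  regroup = solve-∀
  shift : ∀ m k → m + 2 * suc k ≡ 2 + m + 2 * k
  shift = solve-∀
  collect : ∀ m k y → (1 + m) * ((2 + m + 2 * k) * y) + (2 + m + 2 * k) * (2 + 2 * k) * y
          ≡ (3 + m + 2 * k) * ((2 + m + 2 * k) * y)
  collect = solve-∀

H-G : ∀ m k → H (m + k) m ≡ ℕ→ℚ (G m k)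
H-G m k = begin
  H (m + k) m                                    ≡⟨ /-cong {{nonZero (m + k ∸ m)}} (cong +_ numerator) denominator ⟩
  (+ (G m k * (2 ^ k * k !))) / (2 ^ k * k !)    ≡⟨ /-cancel (G m k) (2 ^ k * k !) ⟩
  ℕ→ℚ (G m k)                                    ∎
  where
  nonZero : ∀ d → NonZero (2 ^ d * d !)
  nonZero d = m*n≢0 (2 ^ d) (d !) {{m^n≢0 2 d}} {{d !≢0}}
  instance
    _ : NonZero (2 ^ k * k !)
    _ = nonZero k
  numerator : (2 * (m + k) ∸ m) ! ≡ G m k * (2 ^ k * k !)
  numerator = trans (cong _! (trans (cong (_∸ m) (split m k)) (ℕ.m+n∸m≡n m (m + 2 * k)))) (sym (G-closed m k))
    where
    split : ∀ m k → 2 * (m + k) ≡ m + (m + 2 * k)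
    split = solve-∀
  denominator : 2 ^ (m + k ∸ m) * (m + k ∸ m) ! ≡ 2 ^ k * k !
  denominator = cong (λ d → 2 ^ d * d !) (ℕ.m+n∸m≡n m k)

-- The recurrence of G, in the three shapes in which Dᶜ produces it.
G-step-a : ∀ m → ℕ→ℚ (G m 0) *ℚ ℕ→ℚ (suc m) ≡ ℕ→ℚ (G (suc m) 0)
G-step-a m = trans (sym (ℕ→ℚ-* (G m 0) (suc m))) (cong ℕ→ℚ (ℕ.*-comm (G m 0) (suc m)))

G-step-c : ∀ k → ℕ→ℚ (G 0 k) *ℚ ℕ→ℚ (suc k + k) ≡ ℕ→ℚ (G 0 (suc k))
G-step-c k = trans (sym (ℕ→ℚ-* (G 0 k) (suc k + k))) (cong ℕ→ℚ (reorder k (G 0 k)))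
  where
  reorder : ∀ k g → g * (suc k + k) ≡ (1 + 2 * k) * g
  reorder = solve-∀

G-step : ∀ m k → ℕ→ℚ (G m (suc k)) *ℚ ℕ→ℚ (suc m) +ℚ ℕ→ℚ (G (suc m) k) *ℚ ℕ→ℚ (suc (m + suc k) + k)
               ≡ ℕ→ℚ (G (suc m) (suc k))
G-step m k = begin
  ℕ→ℚ g₁ *ℚ ℕ→ℚ (suc m) +ℚ ℕ→ℚ g₂ *ℚ ℕ→ℚ w  ≡⟨ cong₂ _+ℚ_ (ℕ→ℚ-* g₁ (suc m)) (ℕ→ℚ-* g₂ w) ⟨
  ℕ→ℚ (g₁ * suc m) +ℚ ℕ→ℚ (g₂ * w)           ≡⟨ ℕ→ℚ-+ (g₁ * suc m) (g₂ * w) ⟨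
  ℕ→ℚ (g₁ * suc m + g₂ * w)                   ≡⟨ cong ℕ→ℚ (reorder m k g₁ g₂) ⟩
  ℕ→ℚ (G (suc m) (suc k))                     ∎
  where
  g₁ g₂ w : ℕ
  g₁ = G m (suc k)
  g₂ = G (suc m) k
  w  = suc (m + suc k) + k
  reorder : ∀ m k g₁ g₂ → g₁ * suc m + g₂ * (suc (m + suc k) + k) ≡ suc m * g₁ + (2 + m + 2 * k) * g₂
  reorder = solve-∀

-- 5. The coefficient profile of D^n(ab)

-- a^(m+1) b^j c^k lies on level n when j = n+1 and m + k = n.
level? : ∀ n m j k → Dec (j ≡ suc n × m + k ≡ n)
level? n m j k = j ≟ suc n ×-dec m + k ≟ n

Φ : ℕ → Coeffs
Φ n zero    j k = 0ℚ
Φ n (suc m) j k = ⟦ level? n m j k ⟧ ℕ→ℚ (G m k)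

-- One application of D moves the profile of level n to that of level n+1: the
-- recurrence of G, with the index bookkeeping of the conditions.
Dᶜ-Φ : ∀ n i j k → Dᶜ (Φ n) i j k ≡ Φ (suc n) i j k
Dᶜ-Φ n zero          zero    k       = refl
Dᶜ-Φ n zero          (suc j) zero    = refl
Dᶜ-Φ n zero          (suc j) (suc k) = trans (+-identityˡ _) (*-zeroˡ (ℕ→ℚ (j + k)))
Dᶜ-Φ n (suc m)       zero    k       = sym (⟦⟧-off λ ())
Dᶜ-Φ n (suc zero)    (suc j) zero    = sym (⟦⟧-off λ { (_ , ()) })
Dᶜ-Φ n (suc zero)    (suc j) (suc k) = trans (+-identityˡ _) (trans ⟦⟧-*ʳ
  (⟦⟧-cong (mk⇔ (λ { (refl , refl) → refl , refl }) (λ { (refl , refl) → refl , refl }))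
           (λ { (refl , refl) → G-step-c k })))
Dᶜ-Φ n (suc (suc m)) (suc j) zero    = trans (+-identityʳ _) (trans ⟦⟧-*ʳ
  (⟦⟧-cong (mk⇔ (λ { (refl , refl) → refl , refl }) (λ { (refl , refl) → refl , refl }))
           (λ { (refl , refl) → G-step-a m })))
Dᶜ-Φ n (suc (suc m)) (suc j) (suc k) = trans (cong₂ _+ℚ_ ⟦⟧-*ʳ ⟦⟧-*ʳ)
  (⟦⟧-+-cong (mk⇔ (λ { (refl , refl) → refl , refl }) (λ { (refl , refl) → refl , refl }))
             (mk⇔ (λ { (refl , refl) → refl , cong suc (ℕ.+-suc m k) })
                  (λ { (refl , refl) → refl , sym (ℕ.+-suc m k) }))
             (λ { (refl , refl) → G-step m k }))

-- 6. The right-hand side and the theorem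

coeff-mono-a⁰ : ∀ q m j' k' j k → coeff (mono q (suc m) j' k') 0 j k ≡ 0ℚ
coeff-mono-a⁰ q m j' k' j k = trans (coeff-mono q (suc m) j' k' 0 j k) (⟦⟧-off λ ())

coeff-Σmono-0 : ∀ (h : ℕ → ℚ) J (K : ℕ → ℕ) n j k → coeff (Σ≤ n (λ m → mono (h m) (suc m) J (K m))) 0 j k ≡ 0ℚ
coeff-Σmono-0 h J K zero    j k = coeff-mono-a⁰ (h 0) 0 J (K 0) j k
coeff-Σmono-0 h J K (suc n) j k = begin
  coeff (Σ≤ n f ++ f (suc n)) 0 j k                 ≡⟨ coeff-++ (Σ≤ n f) (f (suc n)) 0 j k ⟩
  coeff (Σ≤ n f) 0 j k +ℚ coeff (f (suc n)) 0 j k  ≡⟨ cong₂ _+ℚ_ (coeff-Σmono-0 h J K n j k) (coeff-mono-a⁰ (h (suc n)) (suc n) J (K (suc n)) j k) ⟩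
  0ℚ +ℚ 0ℚ                                          ≡⟨ +-identityʳ 0ℚ ⟩
  0ℚ                                                ∎
  where
  f : ℕ → Poly
  f m = mono (h m) (suc m) J (K m)

coeff-Σmono : ∀ (h : ℕ → ℚ) J (K : ℕ → ℕ) n i j k →
  coeff (Σ≤ n (λ m → mono (h m) (suc m) J (K m))) (suc i) j k ≡ ⟦ i ≤? n ×-dec j ≟ J ×-dec k ≟ K i ⟧ h i
coeff-Σmono h J K zero    i j k = trans (coeff-mono (h 0) 1 J (K 0) (suc i) j k)
  (⟦⟧-cong (mk⇔ (λ { (refl , x) → z≤n , x }) (λ { (z≤n , x) → refl , x })) (λ { (refl , _) → refl }))
coeff-Σmono h J K (suc n) i j k = begin
  coeff (Σ≤ n f ++ f (suc n)) (suc i) j k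
    ≡⟨ coeff-++ (Σ≤ n f) (f (suc n)) (suc i) j k ⟩
  coeff (Σ≤ n f) (suc i) j k +ℚ coeff (f (suc n)) (suc i) j k
    ≡⟨ cong₂ _+ℚ_ (coeff-Σmono h J K n i j k) (coeff-mono (h (suc n)) (suc (suc n)) J (K (suc n)) (suc i) j k) ⟩
  ⟦ i ≤? n ×-dec j ≟ J ×-dec k ≟ K i ⟧ h i +ℚ ⟦ suc i ≟ suc (suc n) ×-dec j ≟ J ×-dec k ≟ K (suc n) ⟧ h (suc n)
    ≡⟨ ⟦⟧-extend (λ m → j ≟ J ×-dec k ≟ K m) h n i ⟩
  ⟦ i ≤? suc n ×-dec j ≟ J ×-dec k ≟ K i ⟧ h i
    ∎
  where
  f : ℕ → Poly
  f m = mono (h m) (suc m) J (K m)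

R : ℕ → Poly
R n = Σ≤ n (λ m → mono (H n m) (suc m) (suc n) (n ∸ m))

-- Its coefficients are the profile of level n: m ≤ n with k = n - m means m + k = n,
-- and there H(n,m) = G(m,k).
coeff-R : ∀ n i j k → coeff (R n) i j k ≡ Φ n i j k
coeff-R n zero    j k = coeff-Σmono-0 (H n) (suc n) (n ∸_) n j k
coeff-R n (suc i) j k = trans (coeff-Σmono (H n) (suc n) (n ∸_) n i j k)
  (⟦⟧-cong (mk⇔ (λ { (i≤n , refl , refl) → refl , ℕ.m+[n∸m]≡n i≤n })
                (λ { (refl , refl) → ℕ.m≤m+n i k , refl , sym (ℕ.m+n∸m≡n i k) }))
           (λ { (i≤n , refl , refl) → trans (cong (λ N → H N i) (sym (ℕ.m+[n∸m]≡n i≤n))) (H-G i (n ∸ i)) }))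

-- The coefficients of D^n(ab) form the profile of level n; the base case holds because
-- ab is literally R 0 (H(0,0) = 1).
coeff-D^ : ∀ n i j k → coeff (D^ n (a ⊗ b)) i j k ≡ Φ n i j k
coeff-D^ zero    = coeff-R 0
coeff-D^ (suc n) i j k = begin
  coeff (D (D^ n (a ⊗ b))) i j k  ≡⟨ coeff-D (D^ n (a ⊗ b)) i j k ⟩
  Dᶜ (coeff (D^ n (a ⊗ b))) i j k ≡⟨ Dᶜ-cong (coeff-D^ n) i j k ⟩
  Dᶜ (Φ n) i j k                  ≡⟨ Dᶜ-Φ n i j k ⟩
  Φ (suc n) i j k                 ∎

mono-cong : ∀ {q q' i i' j j' k k'} → q ≡ q' → i ≡ i' → j ≡ j' → k ≡ k' → mono q i j k ≡ mono q' i' j' k'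
mono-cong refl refl refl refl = refl

mono-↑ : ∀ i j k m → mono 1ℚ i j k ↑ m ≡ mono 1ℚ (m * i) (m * j) (m * k)
mono-↑ i j k zero    = refl
mono-↑ i j k (suc m) = cong (mono 1ℚ i j k ⊗_) (mono-↑ i j k m)

Σ≤-cong : ∀ {f g : ℕ → Poly} → (∀ m → f m ≡ g m) → ∀ n → Σ≤ n f ≡ Σ≤ n g
Σ≤-cong f≡g zero    = f≡g 0
Σ≤-cong f≡g (suc n) = cong₂ _++_ (Σ≤-cong f≡g n) (f≡g (suc n))

map-Σ≤ : ∀ (h : Term → Term) (f : ℕ → Poly) n → map h (Σ≤ n f) ≡ Σ≤ n (λ m → map h (f m))
map-Σ≤ h f zero    = refl
map-Σ≤ h f (suc n) = trans (map-++ h (Σ≤ n f) (f (suc n))) (cong (_++ map h (f (suc n))) (map-Σ≤ h f n))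

rhs-normal-form : ∀ n → a ⊗ (b ↑ (n + 1)) ⊗ Σ≤ n (λ k → H n k · ((a ↑ k) ⊗ (c ↑ (n ∸ k)))) ≡ R n
rhs-normal-form n = begin
  a ⊗ (b ↑ (n + 1)) ⊗ Σ≤ n summand              ≡⟨ cong (λ p → a ⊗ p ⊗ Σ≤ n summand) (mono-↑ 0 1 0 (n + 1)) ⟩
  map (mulTerm ab^n+1) (Σ≤ n summand) ++ []     ≡⟨ ++-identityʳ _ ⟩
  map (mulTerm ab^n+1) (Σ≤ n summand)           ≡⟨ map-Σ≤ (mulTerm ab^n+1) summand n ⟩
  Σ≤ n (λ m → map (mulTerm ab^n+1) (summand m)) ≡⟨ Σ≤-cong normalise n ⟩
  R n                                            ∎
  where
  summand : ℕ → Poly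
  summand k = H n k · ((a ↑ k) ⊗ (c ↑ (n ∸ k)))
  -- a b^(n+1), as computed by ⊗ and ↑
  ab^n+1 : Term
  ab^n+1 = term 1ℚ (suc ((n + 1) * 0)) ((n + 1) * 1) ((n + 1) * 0)
  normalise : ∀ m → map (mulTerm ab^n+1) (summand m) ≡ mono (H n m) (suc m) (suc n) (n ∸ m)
  normalise m = begin
    map (mulTerm ab^n+1) (summand m)
      ≡⟨ cong (λ p → map (mulTerm ab^n+1) (H n m · p)) (cong₂ _⊗_ (mono-↑ 1 0 0 m) (mono-↑ 0 0 1 (n ∸ m))) ⟩
    mono (1ℚ *ℚ (H n m *ℚ 1ℚ)) (suc ((n + 1) * 0) + (m * 1 + x * 0)) ((n + 1) * 1 + (m * 0 + x * 0)) ((n + 1) * 0 + (m * 0 + x * 1))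
      ≡⟨ mono-cong (trans (*-identityˡ _) (*-identityʳ (H n m))) (cong suc (a-exp n m x)) (b-exp n m x) (c-exp n m x) ⟩
    mono (H n m) (suc m) (suc n) x
      ∎
    where
    x : ℕ
    x = n ∸ m
    a-exp : ∀ n m x → (n + 1) * 0 + (m * 1 + x * 0) ≡ m
    a-exp = solve-∀
    b-exp : ∀ n m x → (n + 1) * 1 + (m * 0 + x * 0) ≡ suc n
    b-exp = solve-∀
    c-exp : ∀ n m x → (n + 1) * 0 + (m * 0 + x * 1) ≡ x
    c-exp = solve-∀

mainTheorem7 : (n : ℕ) →
    D^ n (a ⊗ b) ≈ a ⊗ (b ↑ (n + 1)) ⊗ Σ≤ n (λ k → H n k · ((a ↑ k) ⊗ (c ↑ (n ∸ k))))
mainTheorem7 n i j k = begin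
  coeff (D^ n (a ⊗ b)) i j k ≡⟨ coeff-D^ n i j k ⟩
  Φ n i j k                  ≡⟨ coeff-R n i j k ⟨
  coeff (R n) i j k          ≡⟨ cong (λ p → coeff p i j k) (rhs-normal-form n) ⟨
  coeff (a ⊗ (b ↑ (n + 1)) ⊗ Σ≤ n (λ k → H n k · ((a ↑ k) ⊗ (c ↑ (n ∸ k))))) i j k ∎
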